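{- Let $G$ be a finite simple graph with minimum degree at least $3$. Let $v_0$ be a vertex of $G$, let $P$ be a longest path among all paths of $G$ starting at $v_0$, and let $(S,T)$ be the corresponding Pósa pair, with $s=|S|$, $t=|T|$. Let $T_1$ be the set of vertices $v\in T$ having exactly one neighbour in $S$, and $t_1=|T_1|$. Let $G^*$ be the graph with vertex set $S\cup(T\setminus T_1)$ whose edges are the edges of $G$ joining two vertices of $S\cup (T\setminus T_1)$ with at least one endpoint in $S$. Write $d(v;G^*)$ for the degree of $v$ in $G^*$, and let $S_2=\{v\in S: d(v;G^*)=2\}$. Then: (i) No vertex of $S_2$ is adjacent (in $G^*$) both to a vertex of $S_2$ and to a vertex of $T\setminus T_1$. (ii) Suppose $e(S\cup T)=(1+\sigma)(s+t)$ for some $\sigma>0$. Then $$s-2\sigma(s+t)\le t_1\le s,$$ and $$\sum_{v\in S\cup(T\setminus T_1)}\bigl[d(v;G^*)-2\bigr]\le 2\sigma(s+t).$$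
   Context: Pósa rotations: if $P=x_0x_1\dots x_h$ (with $x_0=v_0$) is a longest path from $v_0$ and $x_h$ is adjacent to $x_i$ for some $i<h-1$, then $x_0\dots x_i x_h x_{h-1}\dots x_{i+1}$ is a path from $v_0$ of the same length; it is said to be obtained from $P$ by a rotation. $S$ is the set consisting of $x_h$ together with the endpoints (other than $v_0$) of all paths obtainable from $P$ by any finite sequence of rotations. $T=N(S)$ is the set of vertices not in $S$ that are adjacent to some vertex of $S$. For $A\subseteq V(G)$, $e(A)$ denotes the number of edges of the subgraph of $G$ induced by $A$. -}

module Defs where

open import Data.Nat using (ℕ; _≤_; _<ᵇ_; _≡ᵇ_)
open import Data.Bool using (Bool; true; false; _∧_; _∨_; not; if_then_else_)
open import Data.Fin using (Fin; toℕ)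
open import Data.List using (List; []; _∷_; _++_; reverse; length; allFin; map; filter; foldr)
open import Data.Nat.ListAction using (sum)
open import Data.List.Relation.Unary.Unique.Propositional using (Unique)
open import Data.Product using (Σ; ∃; _×_; _,_)
open import Data.Integer using (+_)
open import Data.Rational using (ℚ; _/_; _+_; _-_; 0ℚ)
open import Relation.Binary.PropositionalEquality using (_≡_)
open import Relation.Binary.Construct.Closure.ReflexiveTransitive using (Star)

record SimpleGraph (n : ℕ) : Set where
  field
    adj    : Fin n → Fin n → Bool
    sym    : ∀ u v → adj u v ≡ adj v u
    irrefl : ∀ v → adj v v ≡ false

ℕtoℚ : ℕ → ℚ
ℕtoℚ k = + k / 1

count : {n : ℕ} → (Fin n → Bool) → ℕ
count {n} p = sum (map (λ i → if p i then 1 else 0) (allFin n))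

sumℚ : {n : ℕ} → (Fin n → Bool) → (Fin n → ℚ) → ℚ
sumℚ {n} A f = foldr (λ i acc → (if A i then f i else 0ℚ) + acc) 0ℚ (allFin n)

module _ {n : ℕ} (G : SimpleGraph n) where
  open SimpleGraph G

  degree : Fin n → ℕ
  degree v = count (adj v)

  MinDegreeAtLeast : ℕ → Set
  MinDegreeAtLeast k = ∀ v → k ≤ degree v

  data IsWalk : List (Fin n) → Set where
    walk[]  : IsWalk []
    walk[_] : ∀ x → IsWalk (x ∷ [])
    walk∷   : ∀ {x y xs} → adj x y ≡ true → IsWalk (y ∷ xs) → IsWalk (x ∷ y ∷ xs)

  IsPathFrom : Fin n → List (Fin n) → Set
  IsPathFrom v0 P = IsWalk P × Unique P × ∃ λ rest → P ≡ v0 ∷ rest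

  IsLongestPathFrom : Fin n → List (Fin n) → Set
  IsLongestPathFrom v0 P =
    IsPathFrom v0 P × (∀ Q → IsPathFrom v0 Q → length Q ≤ length P)

  -- Pósa rotation: x0..xi x_{i+1}..x_{h-1} xh  ↦  x0..xi xh x_{h-1}..x_{i+1},
  -- where xh ~ xi and i < h-1 (so x_{i+1} ≠ xh; b is x_{i+1}).
  data Rotation : List (Fin n) → List (Fin n) → Set where
    rot : ∀ (A : List (Fin n)) (xi b : Fin n) (B : List (Fin n)) (xh : Fin n) →
          adj xi xh ≡ true →
          Rotation (A ++ xi ∷ b ∷ B ++ xh ∷ [])
                   (A ++ xi ∷ reverse (b ∷ B ++ xh ∷ []))

  PosaEnd : List (Fin n) → Fin n → Set
  PosaEnd P v = ∃ λ Q → Star Rotation P Q × ∃ λ Q' → Q ≡ Q' ++ v ∷ []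

  module PosaSets (S : Fin n → Bool) where
    nbrsIn : Fin n → ℕ
    nbrsIn v = count (λ u → S u ∧ adj v u)

    T : Fin n → Bool
    T v = not (S v) ∧ not (nbrsIn v ≡ᵇ 0)

    T₁ : Fin n → Bool
    T₁ v = T v ∧ (nbrsIn v ≡ᵇ 1)

    TminusT₁ : Fin n → Bool
    TminusT₁ v = T v ∧ not (T₁ v)

    SunionT : Fin n → Bool
    SunionT v = S v ∨ T v

    V* : Fin n → Bool
    V* v = S v ∨ TminusT₁ v

    adj* : Fin n → Fin n → Bool
    adj* u v = adj u v ∧ V* u ∧ V* v ∧ (S u ∨ S v)

    deg* : Fin n → ℕ
    deg* v = count (adj* v)

    S₂ : Fin n → Bool
    S₂ v = S v ∧ (deg* v ≡ᵇ 2)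

    s t t₁ : ℕ
    s = count S
    t = count T
    t₁ = count T₁

  e : (Fin n → Bool) → ℕ
  e A = sum (map (λ u → count (λ v → A u ∧ A v ∧ adj u v ∧ (toℕ u <ᵇ toℕ v))) (allFin n))

module Submission where

-- Pósa's lemma drives everything: a neighbour z of the endpoint v of a path obtained from P by
-- rotations lies on that path (P is longest), and either z precedes v, or rotating at z makes the
-- successor of z an endpoint, i.e. a vertex of S adjacent to z.  A vertex of T₁ has only one
-- neighbour in S, so it precedes each of its S-neighbours; hence a vertex of S has at most one
-- neighbour in T₁ and t₁ ≤ s.
--
-- (i) Let v ∈ S₂ have an S₂-neighbour u and a (T∖T₁)-neighbour w.  As d(u;G*) = 2 < 3 ≤ d(u), u has
-- a T₁-neighbour, which precedes u on a path ending at u; so v does not, and v is followed on that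
-- path by a vertex b ∈ S.  Then u, w, b are three distinct G*-neighbours of v.
--
-- (ii) A vertex of S has G*-degree at least 3 minus its number of T₁-neighbours, a vertex of T∖T₁
-- has G*-degree at least 2, and every edge inside S ∪ T is at most one of: a G*-edge, an S–T₁ edge.
-- This gives s + 2|V(G*)| ≤ Σ d(v;G*) + t₁ and Σ d(v;G*) + 2t₁ ≤ 2e(S ∪ T), and with
-- |V(G*)| + t₁ = s + t and e(S ∪ T) = (1 + σ)(s + t) both inequalities follow.

open import Defs
open import Data.Bool using (Bool; true; false; _∧_; _∨_; not; if_then_else_)
open import Data.Bool.Properties using (T-≡; ¬-not; ∧-zeroʳ; ∧-identityʳ; ∧-comm; ∨-zeroʳ; ∨-inverseʳ)
open import Data.Empty using (⊥; ⊥-elim)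
open import Data.Fin using (Fin; zero; suc; toℕ)
open import Data.Fin.Properties using (_≟_; 0≢1+n; suc-injective; toℕ-injective)
import Data.Integer as ℤ
import Data.Integer.Properties as ℤ
open import Data.List using (List; []; _∷_; _++_; [_]; map; foldr; allFin; tabulate; length; reverse)
open import Data.List.Properties
  using (map-tabulate; map-cong; map-cong-local; ++-assoc; unfold-reverse; reverse-++; length-++; ∷ʳ-injectiveʳ)
open import Data.List.Membership.Propositional using (_∈_; _∉_)
open import Data.List.Membership.Propositional.Properties using (∈-∃++; ∈-++⁻; ∈-++⁺ʳ)
open import Data.List.Relation.Binary.Permutation.Propositional using (_↭_; prep; ↭-sym; ↭⇒↭ₛ)
open import Data.List.Relation.Binary.Permutation.Propositional.Properties using (++⁺ˡ; ↭-reverse; ↭-length)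
open import Data.List.Relation.Binary.Permutation.Setoid.Properties using (Unique-resp-↭)
open import Data.List.Relation.Unary.All as All using (All; []; _∷_)
open import Data.List.Relation.Unary.AllPairs using ([]; _∷_)
open import Data.List.Relation.Unary.Any using (here; there; any?)
open import Data.List.Relation.Unary.Unique.Propositional using (Unique)
open import Data.List.Relation.Unary.Unique.Propositional.Properties using (++⁺)
open import Data.Nat using (ℕ; zero; suc; _≤_; _+_; _≡ᵇ_; _<ᵇ_; z≤n; s≤s)
open import Data.Nat.Coprimality using (1-coprimeTo) renaming (sym to coprime-sym)
open import Data.Nat.ListAction using (sum)
open import Data.Nat.Properties
  using (≡ᵇ⇒≡; n≮n; m+1+n≰m; ≤-refl; ≤-trans; ≤-reflexive; +-mono-≤; +-monoˡ-≤; +-monoʳ-≤; +-cancelˡ-≤; m≤m+n;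
         +-commutativeSemigroup; +-0-commutativeMonoid; module ≤-Reasoning)
open import Algebra.Properties.CommutativeSemigroup +-commutativeSemigroup using (x∙yz≈y∙xz)
import Algebra.Properties.CommutativeMonoid.Sum +-0-commutativeMonoid as VectorSum
open import Data.Nat.Solver using (module +-*-Solver)
open import Data.Product using (∃; _×_; _,_; proj₁; proj₂)
import Data.Product as Product
open import Data.Rational using (ℚ; mkℚ; _/_; 0ℚ; 1ℚ; _<_; _-_; _*_; -_; *≤*)
  renaming (_+_ to _+ℚ_; _≤_ to _≤ℚ_)
import Data.Rational.Properties as ℚ
import Data.Rational.Solver as ℚ-Solver
open import Data.Sum using (_⊎_; inj₁; inj₂)
open import Data.Vec.Functional using (updateAt)
open import Data.Vec.Functional.Properties using (updateAt-minimal)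
open import Function using (id; _∘_; const; flip)
open import Function.Bundles using (_⇔_; Equivalence)
open import Relation.Binary.Construct.Closure.ReflexiveTransitive using (Star; ε; _◅_; _◅◅_)
open import Relation.Binary.PropositionalEquality
  using (_≡_; _≢_; _≗_; refl; sym; trans; cong; cong₂; subst; subst₂; setoid; module ≡-Reasoning)
open import Relation.Nullary using (¬_; yes; no)

-- Finite sums over Fin n

⟦_⟧ : Bool → ℕ
⟦ b ⟧ = if b then 1 else 0

-- With this definition count p is definitionally ∑ (⟦_⟧ ∘ p).
∑ : {n : ℕ} → (Fin n → ℕ) → ℕ
∑ {n} f = sum (map f (allFin n))

module _ {n : ℕ} where

  ∑≡sum : (f : Fin n → ℕ) → ∑ f ≡ VectorSum.sum f
  ∑≡sum f = trans (cong sum (map-tabulate id f)) (sum-tabulate f)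
    where
    sum-tabulate : ∀ {m} (g : Fin m → ℕ) → sum (tabulate g) ≡ VectorSum.sum g
    sum-tabulate {zero}  g = refl
    sum-tabulate {suc m} g = cong (g zero +_) (sum-tabulate (g ∘ suc))

  ∑-cong : {f g : Fin n → ℕ} → f ≗ g → ∑ f ≡ ∑ g
  ∑-cong f≗g = cong sum (map-cong f≗g (allFin n))

  ∑-mono : {f g : Fin n → ℕ} → (∀ i → f i ≤ g i) → ∑ f ≤ ∑ g
  ∑-mono {f} {g} f≤g = go (allFin n)
    where
    go : ∀ is → sum (map f is) ≤ sum (map g is)
    go []       = z≤n
    go (i ∷ is) = +-mono-≤ (f≤g i) (go is)

  ∑-distrib-+ : (f g : Fin n → ℕ) → ∑ (λ i → f i + g i) ≡ ∑ f + ∑ g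
  ∑-distrib-+ f g = begin
    ∑ (λ i → f i + g i)                ≡⟨ ∑≡sum _ ⟩
    VectorSum.sum (λ i → f i + g i)    ≡⟨ VectorSum.∑-distrib-+ f g ⟩
    VectorSum.sum f + VectorSum.sum g  ≡⟨ cong₂ _+_ (∑≡sum f) (∑≡sum g) ⟨
    ∑ f + ∑ g                          ∎
    where open ≡-Reasoning

  ∑-distrib-+₃ : (f g h : Fin n → ℕ) → ∑ (λ i → f i + (g i + h i)) ≡ ∑ f + (∑ g + ∑ h)
  ∑-distrib-+₃ f g h = trans (∑-distrib-+ f _) (cong (∑ f +_) (∑-distrib-+ g h))

  ∑-updateAt : (f : Fin n → ℕ) (i : Fin n) → ∑ f ≡ f i + ∑ (updateAt f i (const 0))
  ∑-updateAt f i = begin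
    ∑ f                                            ≡⟨ ∑≡sum f ⟩
    VectorSum.sum f                                ≡⟨ sum-updateAt f i ⟩
    f i + VectorSum.sum (updateAt f i (const 0))   ≡⟨ cong (f i +_) (∑≡sum _) ⟨
    f i + ∑ (updateAt f i (const 0))               ∎
    where
    open ≡-Reasoning
    sum-updateAt : ∀ {m} (g : Fin m → ℕ) j → VectorSum.sum g ≡ g j + VectorSum.sum (updateAt g j (const 0))
    sum-updateAt g zero    = refl
    sum-updateAt g (suc j) =
      trans (cong (g zero +_) (sum-updateAt (g ∘ suc) j)) (x∙yz≈y∙xz (g zero) (g (suc j)) _)

  ∑-distinct : (f : Fin n → ℕ) {is : List (Fin n)} → Unique is → sum (map f is) ≤ ∑ f
  ∑-distinct f {[]}     []                 = z≤n
  ∑-distinct f {i ∷ is} (i∉is ∷ is-unique) = begin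
    f i + sum (map f is)   ≡⟨ cong (λ xs → f i + sum xs) (map-cong-local (All.map f≡f′ i∉is)) ⟩
    f i + sum (map f′ is)  ≤⟨ +-monoʳ-≤ (f i) (∑-distinct f′ is-unique) ⟩
    f i + ∑ f′             ≡⟨ ∑-updateAt f i ⟨
    ∑ f                    ∎
    where
    open ≤-Reasoning
    f′ : Fin n → ℕ
    f′ = updateAt f i (const 0)
    f≡f′ : ∀ {j} → i ≢ j → f j ≡ f′ j
    f≡f′ i≢j = sym (updateAt-minimal _ i f (i≢j ∘ sym))

  count-distinct : (p : Fin n → Bool) {is : List (Fin n)} → Unique is → All (λ i → p i ≡ true) is →
                   length is ≤ count p
  count-distinct p is-unique ps = subst (_≤ count p) (sum-ones ps) (∑-distinct (⟦_⟧ ∘ p) is-unique)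
    where
    sum-ones : ∀ {js} → All (λ i → p i ≡ true) js → sum (map (⟦_⟧ ∘ p) js) ≡ length js
    sum-ones []        = refl
    sum-ones (pᵢ ∷ ps) = cong₂ _+_ (cong ⟦_⟧ pᵢ) (sum-ones ps)

  count-mono : {p q : Fin n → Bool} → (∀ i → p i ≡ true → q i ≡ true) → count p ≤ count q
  count-mono {p} {q} p⇒q = ∑-mono (λ i → indicator-mono (p i) (q i) (p⇒q i))
    where
    indicator-mono : ∀ a b → (a ≡ true → b ≡ true) → ⟦ a ⟧ ≤ ⟦ b ⟧
    indicator-mono false b     _   = z≤n
    indicator-mono true  true  _   = s≤s z≤n
    indicator-mono true  false a⇒b with () ← a⇒b refl

∑-comm : ∀ {m n} (f : Fin m → Fin n → ℕ) → ∑ (λ i → ∑ (f i)) ≡ ∑ (λ j → ∑ (λ i → f i j))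
∑-comm f = begin
  ∑ (λ i → ∑ (f i))                                  ≡⟨ ∑∑≡sum f ⟩
  VectorSum.sum (λ i → VectorSum.sum (f i))          ≡⟨ VectorSum.∑-comm f ⟩
  VectorSum.sum (λ j → VectorSum.sum (λ i → f i j))  ≡⟨ ∑∑≡sum (flip f) ⟨
  ∑ (λ j → ∑ (λ i → f i j))                          ∎
  where
  open ≡-Reasoning
  ∑∑≡sum : ∀ {m n} (g : Fin m → Fin n → ℕ) → ∑ (λ i → ∑ (g i)) ≡ VectorSum.sum (λ i → VectorSum.sum (g i))
  ∑∑≡sum g = trans (∑≡sum (λ i → ∑ (g i))) (VectorSum.sum-cong-≗ (λ i → ∑≡sum (g i)))

∑-suc : ∀ {n} (f : Fin (suc n) → ℕ) → ∑ f ≡ f zero + ∑ (f ∘ suc)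
∑-suc f = trans (∑≡sum f) (cong (f zero +_) (sym (∑≡sum (f ∘ suc))))

count≡0 : ∀ {n} {p : Fin n → Bool} → (∀ i → p i ≡ false) → count p ≡ 0
count≡0 {zero}      _       = refl
count≡0 {suc n} {p} p≡false = begin
  count p                       ≡⟨ ∑-suc (⟦_⟧ ∘ p) ⟩
  ⟦ p zero ⟧ + count (p ∘ suc)  ≡⟨ cong₂ _+_ (cong ⟦_⟧ (p≡false zero)) (count≡0 (p≡false ∘ suc)) ⟩
  0                             ∎
  where open ≡-Reasoning

count≤1 : ∀ {n} {p : Fin n → Bool} → (∀ {i j} → p i ≡ true → p j ≡ true → i ≡ j) → count p ≤ 1
count≤1 {zero}      _        = z≤n
count≤1 {suc n} {p} p-unique = subst (_≤ 1) (sym (∑-suc (⟦_⟧ ∘ p))) (head-and-tail (p zero) refl)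
  where
  head-and-tail : ∀ b → p zero ≡ b → ⟦ b ⟧ + count (p ∘ suc) ≤ 1
  head-and-tail true  p₀ =
    ≤-reflexive (cong suc (count≡0 {p = p ∘ suc} (λ i → ¬-not (λ pᵢ → 0≢1+n (p-unique p₀ pᵢ)))))
  head-and-tail false _  = count≤1 (λ pᵢ pⱼ → suc-injective (p-unique pᵢ pⱼ))

count-witness : ∀ {n} {p : Fin n → Bool} → 1 ≤ count p → ∃ λ i → p i ≡ true
count-witness {suc n} {p} 1≤count with p zero in p₀ | subst (1 ≤_) (∑-suc (⟦_⟧ ∘ p)) 1≤count
... | true  | _      = zero , p₀
... | false | 1≤rest with i , pᵢ ← count-witness 1≤rest = suc i , pᵢ

false≢true : false ≢ true
false≢true ()

∧≡true⇒ : ∀ {a b} → a ∧ b ≡ true → a ≡ true × b ≡ true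
∧≡true⇒ {true} b≡true = refl , b≡true

≡ᵇ-true⇒≡ : ∀ {m k} → (m ≡ᵇ k) ≡ true → m ≡ k
≡ᵇ-true⇒≡ {m} {k} eq = ≡ᵇ⇒≡ m k (Equivalence.from T-≡ eq)

<ᵇ-exactly-one : ∀ m n → m ≢ n → ⟦ m <ᵇ n ⟧ + ⟦ n <ᵇ m ⟧ ≡ 1
<ᵇ-exactly-one zero    zero    m≢n = ⊥-elim (m≢n refl)
<ᵇ-exactly-one zero    (suc n) _   = refl
<ᵇ-exactly-one (suc m) zero    _   = refl
<ᵇ-exactly-one (suc m) (suc n) m≢n = <ᵇ-exactly-one m n (m≢n ∘ cong suc)

Unique[xs∷ʳx]⇒x∉xs : ∀ {A : Set} {xs : List A} {x} → Unique (xs ++ [ x ]) → x ∉ xs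
Unique[xs∷ʳx]⇒x∉xs {xs = y ∷ ys} (y∉ys∷ʳx ∷ _) (here refl) = All.lookup y∉ys∷ʳx (∈-++⁺ʳ ys (here refl)) refl
Unique[xs∷ʳx]⇒x∉xs {xs = y ∷ ys} (_ ∷ u)       (there x∈) = Unique[xs∷ʳx]⇒x∉xs u x∈

-- Walks, rotations and the handshake lemma

module _ {n : ℕ} (G : SimpleGraph n) where
  open SimpleGraph G using (adj) renaming (sym to adj-sym; irrefl to adj-irrefl)

  adj⇒≢ : ∀ {u v} → adj u v ≡ true → u ≢ v
  adj⇒≢ {u} u~v refl = false≢true (trans (sym (adj-irrefl u)) u~v)

  walk-++⁻ : ∀ L y M → IsWalk G (L ++ y ∷ M) → IsWalk G (L ++ [ y ]) × IsWalk G (y ∷ M)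
  walk-++⁻ []          y M w           = walk[ y ] , w
  walk-++⁻ (a ∷ [])    y M (walk∷ e w) = walk∷ e walk[ y ] , w
  walk-++⁻ (a ∷ b ∷ L) y M (walk∷ e w) = Product.map₁ (walk∷ e) (walk-++⁻ (b ∷ L) y M w)

  walk-++⁺ : ∀ L y M → IsWalk G (L ++ [ y ]) → IsWalk G (y ∷ M) → IsWalk G (L ++ y ∷ M)
  walk-++⁺ []          y M _            w₂ = w₂
  walk-++⁺ (a ∷ [])    y M (walk∷ e _)  w₂ = walk∷ e w₂
  walk-++⁺ (a ∷ b ∷ L) y M (walk∷ e w₁) w₂ = walk∷ e (walk-++⁺ (b ∷ L) y M w₁ w₂)

  walk-reverse : ∀ xs → IsWalk G xs → IsWalk G (reverse xs)
  walk-reverse []           _           = walk[]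
  walk-reverse (x ∷ [])     _           = walk[ x ]
  walk-reverse (x ∷ y ∷ xs) (walk∷ e w) = subst (IsWalk G) (sym reverse-x∷y∷xs)
    (walk-++⁺ (reverse xs) y [ x ] (subst (IsWalk G) (unfold-reverse y xs) (walk-reverse (y ∷ xs) w))
              (walk∷ (trans (adj-sym y x) e) walk[ x ]))
    where
    reverse-x∷y∷xs : reverse (x ∷ y ∷ xs) ≡ reverse xs ++ y ∷ [ x ]
    reverse-x∷y∷xs = trans (unfold-reverse x (y ∷ xs))
      (trans (cong (_++ [ x ]) (unfold-reverse y xs)) (++-assoc (reverse xs) [ y ] [ x ]))

  walk-rotate : ∀ {Q R} → Rotation G Q R → IsWalk G Q → IsWalk G R
  walk-rotate (rot A xi b B xh xi~xh) w
    with w₁ , walk∷ _ w₂ ← walk-++⁻ A xi (b ∷ B ++ [ xh ]) w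
    = walk-++⁺ A xi _ w₁ (subst (λ L → IsWalk G (xi ∷ L)) (sym reverse-end)
        (walk∷ xi~xh (subst (IsWalk G) reverse-end (walk-reverse _ w₂))))
    where
    reverse-end : reverse (b ∷ B ++ [ xh ]) ≡ xh ∷ reverse (b ∷ B)
    reverse-end = reverse-++ (b ∷ B) [ xh ]

  rotation-↭ : ∀ {Q R} → Rotation G Q R → Q ↭ R
  rotation-↭ (rot A xi b B xh _) = ++⁺ˡ A (prep xi (↭-sym (↭-reverse (b ∷ B ++ [ xh ]))))

  path-rotate : ∀ {v₀ Q R} → Rotation G Q R → IsPathFrom G v₀ Q → IsPathFrom G v₀ R
  path-rotate {v₀} r@(rot A xi _ _ _ _) (w , u , Q-start) =
    walk-rotate r w , Unique-resp-↭ (setoid _) (↭⇒↭ₛ (rotation-↭ r)) u , same-start A Q-start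
    where
    same-start : ∀ A {L L′} → (∃ λ rest → A ++ xi ∷ L ≡ v₀ ∷ rest) → ∃ λ rest → A ++ xi ∷ L′ ≡ v₀ ∷ rest
    same-start []      (_ , refl) = _ , refl
    same-start (a ∷ A) (_ , refl) = _ , refl

  path-∷ʳ : ∀ {v₀ Q′ v z} → IsPathFrom G v₀ (Q′ ++ [ v ]) → adj v z ≡ true → z ∉ Q′ ++ [ v ] →
            IsPathFrom G v₀ ((Q′ ++ [ v ]) ++ [ z ])
  path-∷ʳ {Q′ = Q′} {v} {z} (w , u , rest , Q-start) v~z z∉Q =
    subst (IsWalk G) (sym (++-assoc Q′ [ v ] [ z ])) (walk-++⁺ Q′ v [ z ] w (walk∷ v~z walk[ z ])) ,
    ++⁺ u ([] ∷ []) (λ { (z∈Q , here refl) → z∉Q z∈Q }) ,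
    rest ++ [ z ] , cong (_++ [ z ]) Q-start

  module LongestPath (v₀ : Fin n) (P : List (Fin n)) (P-longest : IsLongestPathFrom G v₀ P) where
    rotated-longest : ∀ {Q} → Star (Rotation G) P Q → IsPathFrom G v₀ Q × length Q ≡ length P
    rotated-longest = go (proj₁ P-longest , refl)
      where
      go : ∀ {Q R} → IsPathFrom G v₀ Q × length Q ≡ length P → Star (Rotation G) Q R →
           IsPathFrom G v₀ R × length R ≡ length P
      go Q-longest           ε        = Q-longest
      go (Q-path , Q-length) (r ◅ rs) =
        go (path-rotate r Q-path , trans (sym (↭-length (rotation-↭ r))) Q-length) rs

    rotated-walk : ∀ {Q} → Star (Rotation G) P Q → IsWalk G Q
    rotated-walk st = proj₁ (proj₁ (rotated-longest st))

    rotated-unique : ∀ {Q} → Star (Rotation G) P Q → Unique Q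
    rotated-unique st = proj₁ (proj₂ (proj₁ (rotated-longest st)))

    endpoint-nbr-on-path : ∀ {Q′ v z} → Star (Rotation G) P (Q′ ++ [ v ]) → adj v z ≡ true → z ∈ Q′
    endpoint-nbr-on-path {Q′} {v} {z} st v~z with any? (z ≟_) (Q′ ++ [ v ])
    ... | no z∉Q =
      ⊥-elim (m+1+n≰m (length (Q′ ++ [ v ])) (subst₂ _≤_ (length-++ (Q′ ++ [ v ])) (sym Q-length)
        (proj₂ P-longest _ (path-∷ʳ Q-path v~z z∉Q))))
      where
      Q-path : IsPathFrom G v₀ (Q′ ++ [ v ])
      Q-path = proj₁ (rotated-longest st)
      Q-length : length (Q′ ++ [ v ]) ≡ length P
      Q-length = proj₂ (rotated-longest st)
    ... | yes z∈Q with ∈-++⁻ Q′ z∈Q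
    ...   | inj₁ z∈Q′        = z∈Q′
    ...   | inj₂ (here refl) = ⊥-elim (adj⇒≢ v~z refl)

    posa-neighbour : ∀ {Q′ v z} → Star (Rotation G) P (Q′ ++ [ v ]) → adj v z ≡ true →
      (∃ λ A → Q′ ≡ A ++ [ z ]) ⊎ (∃ λ b → adj z b ≡ true × PosaEnd G P b × b ∈ Q′)
    posa-neighbour {Q′} {v} {z} st v~z with ∈-∃++ (endpoint-nbr-on-path st v~z)
    ... | A , []    , refl = inj₁ (A , refl)
    ... | A , b ∷ B , refl = inj₂ (b , z~b , (_ , st′ , _ , new-end) , ∈-++⁺ʳ A (there (here refl)))
      where
      Q≡ : (A ++ z ∷ b ∷ B) ++ [ v ] ≡ A ++ z ∷ b ∷ B ++ [ v ]
      Q≡ = ++-assoc A (z ∷ b ∷ B) [ v ]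
      z~b : adj z b ≡ true
      z~b with _ , walk∷ z~b _ ← walk-++⁻ A z (b ∷ B ++ [ v ]) (subst (IsWalk G) Q≡ (rotated-walk st)) = z~b
      st′ : Star (Rotation G) P (A ++ z ∷ reverse (b ∷ B ++ [ v ]))
      st′ = subst (Star (Rotation G) P) Q≡ st ◅◅ (rot A z b B v (trans (adj-sym z v) v~z) ◅ ε)
      new-end : A ++ z ∷ reverse (b ∷ B ++ [ v ]) ≡ (A ++ z ∷ reverse (B ++ [ v ])) ++ [ b ]
      new-end = trans (cong (λ L → A ++ z ∷ L) (unfold-reverse b (B ++ [ v ])))
                      (sym (++-assoc A (z ∷ reverse (B ++ [ v ])) [ b ]))

  handshake : (A : Fin n → Bool) → ∑ (λ u → count (λ v → A u ∧ A v ∧ adj u v)) ≡ e G A + e G A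
  handshake A = begin
    ∑ (λ u → ∑ (λ v → ⟦ A u ∧ A v ∧ adj u v ⟧))          ≡⟨ ∑-cong (λ u → ∑-cong (edge-in-one-order u)) ⟩
    ∑ (λ u → ∑ (λ v → ⟦ E u v ⟧ + ⟦ E v u ⟧))            ≡⟨ ∑-cong (λ u → ∑-distrib-+ (λ v → ⟦ E u v ⟧) _) ⟩
    ∑ (λ u → ∑ (λ v → ⟦ E u v ⟧) + ∑ (λ v → ⟦ E v u ⟧))  ≡⟨ ∑-distrib-+ (λ u → ∑ (λ v → ⟦ E u v ⟧)) _ ⟩
    e G A + ∑ (λ u → ∑ (λ v → ⟦ E v u ⟧))                ≡⟨ cong (e G A +_) (∑-comm (λ u v → ⟦ E v u ⟧)) ⟩
    e G A + e G A                                         ∎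
    where
    open ≡-Reasoning
    E : Fin n → Fin n → Bool
    E u v = A u ∧ A v ∧ adj u v ∧ (toℕ u <ᵇ toℕ v)
    edge-in-one-order : ∀ u v → ⟦ A u ∧ A v ∧ adj u v ⟧ ≡ ⟦ E u v ⟧ + ⟦ E v u ⟧
    edge-in-one-order u v with A u | A v
    ... | false | false = refl
    ... | false | true  = refl
    ... | true  | false = refl
    ... | true  | true rewrite adj-sym v u with adj u v in u~v
    ...   | false = refl
    ...   | true  = sym (<ᵇ-exactly-one (toℕ u) (toℕ v) (adj⇒≢ u~v ∘ toℕ-injective))

-- Every predicate of PosaSets at a vertex v is a Boolean function of the triple
-- (v ∈ S, nbrsIn v ≡ᵇ 0, nbrsIn v ≡ᵇ 1); the functions below are those, written so that
-- e.g. T₁? (profile v) is definitionally T₁ v.  The four patterns are the four classes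
-- S, outside S ∪ T, T₁ and T ∖ T₁.

Profile : Set
Profile = Bool × Bool × Bool

pattern inS     = true  , _     , _
pattern outside = false , true  , _
pattern inT₁    = false , false , true
pattern inT₂    = false , false , false

S? T? T₁? T₂? V*? S∪T? : Profile → Bool
S? (s , _ , _)    = s
T? (s , z , _)    = not s ∧ not z
T₁? p@(_ , _ , o) = T? p ∧ o
T₂? p             = T? p ∧ not (T₁? p)
V*? p             = S? p ∨ T₂? p
S∪T? p            = S? p ∨ T? p

G*-edge? ST₁-edge? : Bool → Profile → Profile → Bool
G*-edge? a p q  = a ∧ V*? p ∧ V*? q ∧ (S? p ∨ S? q)
ST₁-edge? a p q = a ∧ S? p ∧ T₁? q

T₁?⇒inT₁ : ∀ p → T₁? p ≡ true → p ≡ (false , false , true)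
T₁?⇒inT₁ inT₁ _ = refl

T₂?⇒inT₂ : ∀ p → T₂? p ≡ true → p ≡ (false , false , false)
T₂?⇒inT₂ inT₂ _ = refl

V*+T₁≡S+T : ∀ p → ⟦ V*? p ⟧ + ⟦ T₁? p ⟧ ≡ ⟦ S? p ⟧ + ⟦ T? p ⟧
V*+T₁≡S+T inS     = refl
V*+T₁≡S+T outside = refl
V*+T₁≡S+T inT₁    = refl
V*+T₁≡S+T inT₂    = refl

S-nbr-is-G*-nbr : ∀ {a} p q → V*? p ≡ true → S? q ≡ true → a ≡ true → G*-edge? a p q ≡ true
S-nbr-is-G*-nbr inS  inS _ _ refl = refl
S-nbr-is-G*-nbr inT₂ inS _ _ refl = refl

S-edge-split : ∀ p q a → S? p ≡ true → (a ≡ true → S∪T? q ≡ true) →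
               ⟦ a ⟧ ≤ ⟦ G*-edge? a p q ⟧ + ⟦ ST₁-edge? a p q ⟧
S-edge-split p   q       false _ _     = z≤n
S-edge-split inS inS     true  _ _     = s≤s z≤n
S-edge-split inS inT₁    true  _ _     = s≤s z≤n
S-edge-split inS inT₂    true  _ _     = s≤s z≤n
S-edge-split inS outside true  _ q∈S∪T with () ← q∈S∪T refl

edge-accounting : ∀ p q a →
  ⟦ G*-edge? a p q ⟧ + (⟦ ST₁-edge? a p q ⟧ + ⟦ ST₁-edge? a q p ⟧) ≤ ⟦ S∪T? p ∧ S∪T? q ∧ a ⟧
edge-accounting p       q       false = z≤n
edge-accounting inS     inS     true  = s≤s z≤n
edge-accounting inS     outside true  = z≤n
edge-accounting inS     inT₁    true  = s≤s z≤n
edge-accounting inS     inT₂    true  = s≤s z≤n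
edge-accounting outside inS     true  = z≤n
edge-accounting outside outside true  = z≤n
edge-accounting outside inT₁    true  = z≤n
edge-accounting outside inT₂    true  = z≤n
edge-accounting inT₁    inS     true  = s≤s z≤n
edge-accounting inT₁    outside true  = z≤n
edge-accounting inT₁    inT₁    true  = z≤n
edge-accounting inT₁    inT₂    true  = z≤n
edge-accounting inT₂    inS     true  = s≤s z≤n
edge-accounting inT₂    outside true  = z≤n
edge-accounting inT₂    inT₁    true  = z≤n
edge-accounting inT₂    inT₂    true  = z≤n

G*-degree-bound : ∀ p (d m : ℕ) → (S? p ≡ true → 3 ≤ d + m) → (T₂? p ≡ true → 2 ≤ d) →
                  ⟦ S? p ⟧ + (⟦ V*? p ⟧ + ⟦ V*? p ⟧) ≤ (if V*? p then d else 0) + m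
G*-degree-bound inS     d m S-bound _       = S-bound refl
G*-degree-bound outside d m _       _       = z≤n
G*-degree-bound inT₁    d m _       _       = z≤n
G*-degree-bound inT₂    d m _       T-bound = ≤-trans (T-bound refl) (m≤m+n d m)

ℕtoℚ≡mkℚ : ∀ k → ℕtoℚ k ≡ mkℚ (ℤ.+ k) 0 (coprime-sym (1-coprimeTo k))
ℕtoℚ≡mkℚ k = ℚ.normalize-coprime (coprime-sym (1-coprimeTo k))

-- On the normal forms mkℚ (+ a) 0 and mkℚ (+ b) 0, _+ℚ_ unfolds to (+ a * + 1 + + b * + 1) / 1.
ℕtoℚ-+ : ∀ a b → ℕtoℚ (a + b) ≡ ℕtoℚ a +ℚ ℕtoℚ b
ℕtoℚ-+ a b = trans (cong (_/ 1) numerator) (sym (cong₂ _+ℚ_ (ℕtoℚ≡mkℚ a) (ℕtoℚ≡mkℚ b)))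
  where
  numerator : ℤ.+ (a + b) ≡ ℤ.+ a ℤ.* ℤ.+ 1 ℤ.+ ℤ.+ b ℤ.* ℤ.+ 1
  numerator = trans (ℤ.pos-+ a b) (sym (cong₂ ℤ._+_ (ℤ.*-identityʳ (ℤ.+ a)) (ℤ.*-identityʳ (ℤ.+ b))))

ℕtoℚ-mono-≤ : ∀ {a b} → a ≤ b → ℕtoℚ a ≤ℚ ℕtoℚ b
ℕtoℚ-mono-≤ {a} {b} a≤b = subst₂ _≤ℚ_ (sym (ℕtoℚ≡mkℚ a)) (sym (ℕtoℚ≡mkℚ b))
  (*≤* (subst₂ ℤ._≤_ (sym (ℤ.*-identityʳ (ℤ.+ a))) (sym (ℤ.*-identityʳ (ℤ.+ b))) (ℤ.+≤+ a≤b)))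

module _ where
  open ℚ-Solver.+-*-Solver using (solve; _:=_; _:+_; _:*_; _:-_; :-_; con)

  sumℚ-minus-2 : ∀ {n} (A : Fin n → Bool) (f : Fin n → ℕ) →
    sumℚ A (λ v → ℕtoℚ (f v) - ℕtoℚ 2) ≡ ℕtoℚ (∑ (λ v → if A v then f v else 0)) - ℕtoℚ 2 * ℕtoℚ (count A)
  sumℚ-minus-2 {n} A f = go (allFin n)
    where
    sum-on-A size-of-A : List (Fin n) → ℕ
    sum-on-A xs  = sum (map (λ i → if A i then f i else 0) xs)
    size-of-A xs = sum (map (λ i → ⟦ A i ⟧) xs)
    step : ∀ a d c → (ℕtoℚ a - ℕtoℚ 2) +ℚ (ℕtoℚ d - ℕtoℚ 2 * ℕtoℚ c) ≡ ℕtoℚ (a + d) - ℕtoℚ 2 * ℕtoℚ (1 + c)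
    step a d c rewrite ℕtoℚ-+ a d | ℕtoℚ-+ 1 c =
      solve 3 (λ a d c → (a :- con two) :+ (d :- con two :* c) := (a :+ d) :- con two :* (con 1ℚ :+ c))
        refl (ℕtoℚ a) (ℕtoℚ d) (ℕtoℚ c)
      where
      two : ℚ
      two = ℕtoℚ 2
    go : ∀ xs → foldr (λ i acc → (if A i then ℕtoℚ (f i) - ℕtoℚ 2 else 0ℚ) +ℚ acc) 0ℚ xs ≡
                ℕtoℚ (sum-on-A xs) - ℕtoℚ 2 * ℕtoℚ (size-of-A xs)
    go []       = refl
    go (x ∷ xs) with A x
    ... | true  = trans (cong ((ℕtoℚ (f x) - ℕtoℚ 2) +ℚ_) (go xs))
                        (step (f x) (sum-on-A xs) (size-of-A xs))
    ... | false = trans (cong (0ℚ +ℚ_) (go xs)) (ℚ.+-identityˡ _)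

  excess-bound : ∀ d n e w σ → d + (n + n) ≤ (e + e) + (w + w) → ℕtoℚ e ≡ (1ℚ +ℚ σ) * ℕtoℚ n →
                 ℕtoℚ d - ℕtoℚ 2 * ℕtoℚ w ≤ℚ ℕtoℚ 2 * σ * ℕtoℚ n
  excess-bound d n e w σ d+2n≤2e+2w e≡ = begin
    D - two * W                                                 ≡⟨ regroup ⟩
    (D +ℚ (N +ℚ N)) +ℚ c                                        ≤⟨ ℚ.+-monoˡ-≤ c cast ⟩
    ((E +ℚ E) +ℚ (W +ℚ W)) +ℚ c                                 ≡⟨ cong (λ x → ((x +ℚ x) +ℚ (W +ℚ W)) +ℚ c) e≡ ⟩
    (((1ℚ +ℚ σ) * N +ℚ (1ℚ +ℚ σ) * N) +ℚ (W +ℚ W)) +ℚ c        ≡⟨ cancel ⟩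
    two * σ * N                                                 ∎
    where
    open ℚ.≤-Reasoning
    two D N E W c : ℚ
    two = ℕtoℚ 2
    D = ℕtoℚ d
    N = ℕtoℚ n
    E = ℕtoℚ e
    W = ℕtoℚ w
    c = - (N +ℚ N) - two * W
    regroup : D - two * W ≡ (D +ℚ (N +ℚ N)) +ℚ c
    regroup = solve 3 (λ d n w → d :- con two :* w := (d :+ (n :+ n)) :+ (:- (n :+ n) :- con two :* w))
                      refl D N W
    cast : D +ℚ (N +ℚ N) ≤ℚ (E +ℚ E) +ℚ (W +ℚ W)
    cast = subst₂ _≤ℚ_ (trans (ℕtoℚ-+ d _) (cong (D +ℚ_) (ℕtoℚ-+ n n)))
                       (trans (ℕtoℚ-+ (e + e) _) (cong₂ _+ℚ_ (ℕtoℚ-+ e e) (ℕtoℚ-+ w w)))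
                       (ℕtoℚ-mono-≤ d+2n≤2e+2w)
    cancel : (((1ℚ +ℚ σ) * N +ℚ (1ℚ +ℚ σ) * N) +ℚ (W +ℚ W)) +ℚ c ≡ two * σ * N
    cancel = solve 3 (λ σ n w → (((con 1ℚ :+ σ) :* n :+ (con 1ℚ :+ σ) :* n) :+ (w :+ w))
                                :+ (:- (n :+ n) :- con two :* w) := con two :* σ :* n) refl σ N W

  deficit-bound : ∀ s w d t x → s + (w + w) ≤ d + t → ℕtoℚ d - ℕtoℚ 2 * ℕtoℚ w ≤ℚ x → ℕtoℚ s - x ≤ℚ ℕtoℚ t
  deficit-bound s w d t x s+2w≤d+t d-2w≤x = begin
    S - x                     ≤⟨ ℚ.+-monoʳ-≤ S (ℚ.neg-antimono-≤ d-2w≤x) ⟩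
    S - (D - two * W)         ≡⟨ regroup ⟩
    (S +ℚ (W +ℚ W)) +ℚ (- D)  ≤⟨ ℚ.+-monoˡ-≤ (- D) cast ⟩
    (D +ℚ T) +ℚ (- D)         ≡⟨ solve 2 (λ d t → (d :+ t) :+ (:- d) := t) refl D T ⟩
    T                         ∎
    where
    open ℚ.≤-Reasoning
    two S W D T : ℚ
    two = ℕtoℚ 2
    S = ℕtoℚ s
    W = ℕtoℚ w
    D = ℕtoℚ d
    T = ℕtoℚ t
    regroup : S - (D - two * W) ≡ (S +ℚ (W +ℚ W)) +ℚ (- D)
    regroup = solve 3 (λ s d w → s :- (d :- con two :* w) := (s :+ (w :+ w)) :+ (:- d)) refl S D W
    cast : S +ℚ (W +ℚ W) ≤ℚ D +ℚ T
    cast = subst₂ _≤ℚ_ (trans (ℕtoℚ-+ s _) (cong (S +ℚ_) (ℕtoℚ-+ w w))) (ℕtoℚ-+ d t) (ℕtoℚ-mono-≤ s+2w≤d+t)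

-- The Pósa pair of a longest path

module PosaPair {n : ℕ} (G : SimpleGraph n) (min-degree : MinDegreeAtLeast G 3)
  (v₀ : Fin n) (P : List (Fin n)) (P-longest : IsLongestPathFrom G v₀ P)
  (S : Fin n → Bool) (S⇔PosaEnd : ∀ v → (S v ≡ true) ⇔ PosaEnd G P v) where

  open SimpleGraph G using (adj) renaming (sym to adj-sym)
  open PosaSets G S
  open LongestPath G v₀ P P-longest

  profile : Fin n → Profile
  profile v = S v , (nbrsIn v ≡ᵇ 0) , (nbrsIn v ≡ᵇ 1)

  ST₁ : Fin n → Fin n → Bool
  ST₁ v x = adj v x ∧ S v ∧ T₁ x

  S-of-PosaEnd : ∀ {b} → PosaEnd G P b → S b ≡ true
  S-of-PosaEnd {b} = Equivalence.from (S⇔PosaEnd b)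

  S⇒V* : ∀ {v} → S v ≡ true → V* v ≡ true
  S⇒V* {v} Sv = cong (_∨ TminusT₁ v) Sv

  ∈S-≢-∉S : ∀ {a b} → S a ≡ true → S b ≡ false → a ≢ b
  ∈S-≢-∉S Sa Sb refl = false≢true (trans (sym Sb) Sa)

  T₁⇒∉S : ∀ {y} → T₁ y ≡ true → S y ≡ false
  T₁⇒∉S {y} T₁y = cong proj₁ (T₁?⇒inT₁ (profile y) T₁y)

  T₁⇒one-S-nbr : ∀ {y} → T₁ y ≡ true → nbrsIn y ≡ 1
  T₁⇒one-S-nbr {y} T₁y = ≡ᵇ-true⇒≡ (cong (proj₂ ∘ proj₂) (T₁?⇒inT₁ (profile y) T₁y))

  T₂⇒∉S : ∀ {w} → TminusT₁ w ≡ true → S w ≡ false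
  T₂⇒∉S {w} T₂w = cong proj₁ (T₂?⇒inT₂ (profile w) T₂w)

  T₂⇒two-S-nbrs : ∀ {w} → TminusT₁ w ≡ true → 2 ≤ nbrsIn w
  T₂⇒two-S-nbrs {w} T₂w = at-least-2 (nbrsIn w) (cong (proj₁ ∘ proj₂) w∈T₂) (cong (proj₂ ∘ proj₂) w∈T₂)
    where
    w∈T₂ : profile w ≡ (false , false , false)
    w∈T₂ = T₂?⇒inT₂ (profile w) T₂w
    at-least-2 : ∀ k → (k ≡ᵇ 0) ≡ false → (k ≡ᵇ 1) ≡ false → 2 ≤ k
    at-least-2 (suc (suc k)) _ _ = s≤s (s≤s z≤n)

  S-nbr-has-S-nbr : ∀ {v x} → S v ≡ true → adj v x ≡ true → 1 ≤ nbrsIn x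
  S-nbr-has-S-nbr {v} {x} Sv v~x =
    count-distinct (λ u → S u ∧ adj x u) ([] ∷ []) (cong₂ _∧_ Sv (trans (adj-sym x v) v~x) ∷ [])

  S-nbr∈S∪T : ∀ {v x} → S v ≡ true → adj v x ≡ true → SunionT x ≡ true
  S-nbr∈S∪T {v} {x} Sv v~x with nbrsIn x | S-nbr-has-S-nbr Sv v~x
  ... | suc _ | _ = trans (cong (S x ∨_) (∧-identityʳ (not (S x)))) (∨-inverseʳ (S x))

  T₁-unique-S-nbr : ∀ {y a b} → T₁ y ≡ true → S a ≡ true → adj y a ≡ true → S b ≡ true → adj y b ≡ true →
                    a ≡ b
  T₁-unique-S-nbr {y} {a} {b} T₁y Sa y~a Sb y~b with a ≟ b
  ... | yes a≡b = a≡b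
  ... | no  a≢b = ⊥-elim (n≮n 1 (subst (2 ≤_) (T₁⇒one-S-nbr T₁y)
          (count-distinct (λ u → S u ∧ adj y u) ((a≢b ∷ []) ∷ [] ∷ [])
            (cong₂ _∧_ Sa y~a ∷ cong₂ _∧_ Sb y~b ∷ []))))

  T₁-nbr-precedes : ∀ {Q′ v y} → Star (Rotation G) P (Q′ ++ [ v ]) → S v ≡ true → T₁ y ≡ true →
                    adj v y ≡ true → ∃ λ A → Q′ ≡ A ++ [ y ]
  T₁-nbr-precedes {Q′} {v} {y} st Sv T₁y v~y with posa-neighbour st v~y
  ... | inj₁ y-precedes = y-precedes
  ... | inj₂ (b , y~b , b-end , b∈Q′) = ⊥-elim (Unique[xs∷ʳx]⇒x∉xs (rotated-unique st)
          (subst (_∈ Q′) (T₁-unique-S-nbr T₁y (S-of-PosaEnd b-end) y~b Sv (trans (adj-sym y v) v~y)) b∈Q′))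

  ST₁-degree≤S : ∀ v → count (ST₁ v) ≤ ⟦ S v ⟧
  ST₁-degree≤S v = bound (S v) refl
    where
    bound : ∀ b → S v ≡ b → count (ST₁ v) ≤ ⟦ b ⟧
    bound false Sv =
      ≤-reflexive (count≡0 (λ x → trans (cong (λ b → adj v x ∧ b ∧ T₁ x) Sv) (∧-zeroʳ (adj v x))))
    bound true  Sv with Q , st , Q′ , refl ← Equivalence.to (S⇔PosaEnd v) Sv = count≤1 same-predecessor
      where
      predecessor : ∀ {x} → ST₁ v x ≡ true → ∃ λ A → Q′ ≡ A ++ [ x ]
      predecessor ST₁vx with v~x , Sv∧T₁x ← ∧≡true⇒ ST₁vx =
        T₁-nbr-precedes st Sv (proj₂ (∧≡true⇒ {S v} Sv∧T₁x)) v~x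
      same-predecessor : ∀ {x x′} → ST₁ v x ≡ true → ST₁ v x′ ≡ true → x ≡ x′
      same-predecessor ST₁vx ST₁vx′ with A , refl ← predecessor ST₁vx | A′ , eq ← predecessor ST₁vx′ =
        ∷ʳ-injectiveʳ A A′ eq

  ∑ST₁-degree≡t₁ : ∑ (λ v → count (ST₁ v)) ≡ t₁
  ∑ST₁-degree≡t₁ = trans (∑-comm (λ v x → ⟦ ST₁ v x ⟧)) (∑-cong T₁-vertex)
    where
    T₁-vertex : ∀ x → ∑ (λ v → ⟦ adj v x ∧ S v ∧ T₁ x ⟧) ≡ ⟦ T₁ x ⟧
    T₁-vertex x with T₁ x in T₁x
    ... | false = count≡0 (λ v → trans (cong (adj v x ∧_) (∧-zeroʳ (S v))) (∧-zeroʳ (adj v x)))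
    ... | true  = trans (∑-cong (λ v → cong ⟦_⟧ (S-nbr-of v))) (T₁⇒one-S-nbr T₁x)
      where
      S-nbr-of : ∀ v → adj v x ∧ S v ∧ true ≡ S v ∧ adj x v
      S-nbr-of v = trans (cong (adj v x ∧_) (∧-identityʳ (S v)))
                         (trans (∧-comm (adj v x) (S v)) (cong (S v ∧_) (adj-sym v x)))

  t₁≤s : t₁ ≤ s
  t₁≤s = subst (_≤ s) ∑ST₁-degree≡t₁ (∑-mono ST₁-degree≤S)

  S-degree-split : ∀ {v} → S v ≡ true → 3 ≤ deg* v + count (ST₁ v)
  S-degree-split {v} Sv = begin
    3                                     ≤⟨ min-degree v ⟩
    degree G v                            ≤⟨ ∑-mono edge-split ⟩
    ∑ (λ x → ⟦ adj* v x ⟧ + ⟦ ST₁ v x ⟧)  ≡⟨ ∑-distrib-+ (λ x → ⟦ adj* v x ⟧) _ ⟩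
    deg* v + count (ST₁ v)                ∎
    where
    open ≤-Reasoning
    edge-split : ∀ x → ⟦ adj v x ⟧ ≤ ⟦ adj* v x ⟧ + ⟦ ST₁ v x ⟧
    edge-split x = S-edge-split (profile v) (profile x) (adj v x) Sv (S-nbr∈S∪T Sv)

  T₂-degree : ∀ {w} → TminusT₁ w ≡ true → 2 ≤ deg* w
  T₂-degree {w} T₂w = ≤-trans (T₂⇒two-S-nbrs T₂w) (count-mono S-nbr⇒G*-nbr)
    where
    V*w : V* w ≡ true
    V*w = trans (cong (S w ∨_) T₂w) (∨-zeroʳ (S w))
    S-nbr⇒G*-nbr : ∀ x → S x ∧ adj w x ≡ true → adj* w x ≡ true
    S-nbr⇒G*-nbr x Sx∧w~x with Sx , w~x ← ∧≡true⇒ Sx∧w~x =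
      S-nbr-is-G*-nbr (profile w) (profile x) V*w Sx w~x

  S₂⇒T₁-nbr : ∀ {u} → S₂ u ≡ true → ∃ λ y → ST₁ u y ≡ true
  S₂⇒T₁-nbr {u} S₂u with Su , deg*u≡ᵇ2 ← ∧≡true⇒ S₂u =
    count-witness (+-cancelˡ-≤ 2 1 _
      (subst (λ d → 3 ≤ d + count (ST₁ u)) (≡ᵇ-true⇒≡ deg*u≡ᵇ2) (S-degree-split Su)))

  S₂-preceded-by-T₁ : ∀ {Q′ u} → Star (Rotation G) P (Q′ ++ [ u ]) → S₂ u ≡ true →
                      ∃ λ y → T₁ y ≡ true × ∃ λ X → Q′ ≡ X ++ [ y ]
  S₂-preceded-by-T₁ {u = u} st S₂u
    with Su , _ ← ∧≡true⇒ S₂u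
    with y , ST₁uy ← S₂⇒T₁-nbr S₂u
    with u~y , Su∧T₁y ← ∧≡true⇒ ST₁uy
    with _ , T₁y ← ∧≡true⇒ {S u} Su∧T₁y
    = y , T₁y , T₁-nbr-precedes st Su T₁y u~y

  S₂-not-between-S₂-and-T₂ : ∀ {v u w} → S₂ v ≡ true → S₂ u ≡ true → adj* v u ≡ true →
                             TminusT₁ w ≡ true → adj* v w ≡ true → ⊥
  S₂-not-between-S₂-and-T₂ {v} {u} {w} S₂v S₂u v*u T₂w v*w
    with Sv , deg*v≡ᵇ2 ← ∧≡true⇒ S₂v
    with Su , _ ← ∧≡true⇒ S₂u
    with Q , st , Q′ , refl ← Equivalence.to (S⇔PosaEnd u) Su
    with y , T₁y , X , Q′≡X∷ʳy ← S₂-preceded-by-T₁ st S₂u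
    with posa-neighbour st (trans (adj-sym u v) (proj₁ (∧≡true⇒ v*u)))
  ... | inj₁ (A , Q′≡A∷ʳv) = ∈S-≢-∉S Sv (T₁⇒∉S T₁y) (∷ʳ-injectiveʳ A X (trans (sym Q′≡A∷ʳv) Q′≡X∷ʳy))
  ... | inj₂ (b , v~b , b-end , b∈Q′) = n≮n 2 (subst (3 ≤_) (≡ᵇ-true⇒≡ deg*v≡ᵇ2)
          (count-distinct (adj* v) ((u≢w ∷ u≢b ∷ []) ∷ (w≢b ∷ []) ∷ [] ∷ []) (v*u ∷ v*w ∷ v*b ∷ [])))
    where
    Sb : S b ≡ true
    Sb = S-of-PosaEnd b-end
    u≢w : u ≢ w
    u≢w = ∈S-≢-∉S Su (T₂⇒∉S T₂w)
    w≢b : w ≢ b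
    w≢b w≡b = ∈S-≢-∉S Sb (T₂⇒∉S T₂w) (sym w≡b)
    u≢b : u ≢ b
    u≢b refl = Unique[xs∷ʳx]⇒x∉xs (rotated-unique st) b∈Q′
    v*b : adj* v b ≡ true
    v*b = S-nbr-is-G*-nbr (profile v) (profile b) (S⇒V* Sv) Sb v~b

  order* degSum* : ℕ
  order*  = count V*
  degSum* = ∑ (λ v → if V* v then deg* v else 0)

  order*+t₁≡s+t : order* + t₁ ≡ s + t
  order*+t₁≡s+t = begin
    order* + t₁                    ≡⟨ ∑-distrib-+ (λ v → ⟦ V* v ⟧) _ ⟨
    ∑ (λ v → ⟦ V* v ⟧ + ⟦ T₁ v ⟧)  ≡⟨ ∑-cong (V*+T₁≡S+T ∘ profile) ⟩
    ∑ (λ v → ⟦ S v ⟧ + ⟦ T v ⟧)    ≡⟨ ∑-distrib-+ (λ v → ⟦ S v ⟧) _ ⟩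
    s + t                          ∎
    where open ≡-Reasoning

  s+2order*≤degSum*+t₁ : s + (order* + order*) ≤ degSum* + t₁
  s+2order*≤degSum*+t₁ = begin
    s + (order* + order*)                       ≡⟨ ∑-distrib-+₃ (λ v → ⟦ S v ⟧) _ _ ⟨
    ∑ (λ v → ⟦ S v ⟧ + (⟦ V* v ⟧ + ⟦ V* v ⟧))   ≤⟨ ∑-mono vertex-bound ⟩
    ∑ (λ v → deg*-on-V* v + count (ST₁ v))      ≡⟨ ∑-distrib-+ deg*-on-V* _ ⟩
    degSum* + ∑ (λ v → count (ST₁ v))           ≡⟨ cong (degSum* +_) ∑ST₁-degree≡t₁ ⟩
    degSum* + t₁                                ∎
    where
    open ≤-Reasoning
    deg*-on-V* : Fin n → ℕ
    deg*-on-V* v = if V* v then deg* v else 0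
    vertex-bound : ∀ v → ⟦ S v ⟧ + (⟦ V* v ⟧ + ⟦ V* v ⟧) ≤ deg*-on-V* v + count (ST₁ v)
    vertex-bound v = G*-degree-bound (profile v) (deg* v) (count (ST₁ v)) S-degree-split T₂-degree

  edges-at : ∀ v → deg* v + (count (ST₁ v) + ∑ (λ x → ⟦ ST₁ x v ⟧)) ≤
                   count (λ x → SunionT v ∧ SunionT x ∧ adj v x)
  edges-at v = begin
    deg* v + (count (ST₁ v) + ∑ (λ x → ⟦ ST₁ x v ⟧))      ≡⟨ ∑-distrib-+₃ (λ x → ⟦ adj* v x ⟧) _ _ ⟨
    ∑ (λ x → ⟦ adj* v x ⟧ + (⟦ ST₁ v x ⟧ + ⟦ ST₁ x v ⟧))  ≤⟨ ∑-mono edge-at ⟩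
    count (λ x → SunionT v ∧ SunionT x ∧ adj v x)        ∎
    where
    open ≤-Reasoning
    edge-at : ∀ x → ⟦ adj* v x ⟧ + (⟦ ST₁ v x ⟧ + ⟦ ST₁ x v ⟧) ≤ ⟦ SunionT v ∧ SunionT x ∧ adj v x ⟧
    edge-at x rewrite adj-sym x v = edge-accounting (profile v) (profile x) (adj v x)

  degSum*+2t₁≤2e : degSum* + (t₁ + t₁) ≤ e G SunionT + e G SunionT
  degSum*+2t₁≤2e = begin
    degSum* + (t₁ + t₁)
      ≤⟨ +-mono-≤ degSum*≤∑deg* (≤-reflexive t₁+t₁≡) ⟩
    ∑ deg* + (∑ (λ v → count (ST₁ v)) + ∑ (λ v → ∑ (λ x → ⟦ ST₁ x v ⟧)))
      ≡⟨ ∑-distrib-+₃ deg* _ _ ⟨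
    ∑ (λ v → deg* v + (count (ST₁ v) + ∑ (λ x → ⟦ ST₁ x v ⟧)))
      ≤⟨ ∑-mono edges-at ⟩
    ∑ (λ v → count (λ x → SunionT v ∧ SunionT x ∧ adj v x))
      ≡⟨ handshake G SunionT ⟩
    e G SunionT + e G SunionT
      ∎
    where
    open ≤-Reasoning
    if-≤ : ∀ b {k} → (if b then k else 0) ≤ k
    if-≤ true  = ≤-refl
    if-≤ false = z≤n
    degSum*≤∑deg* : degSum* ≤ ∑ deg*
    degSum*≤∑deg* = ∑-mono (λ v → if-≤ (V* v))
    t₁+t₁≡ : t₁ + t₁ ≡ ∑ (λ v → count (ST₁ v)) + ∑ (λ v → ∑ (λ x → ⟦ ST₁ x v ⟧))
    t₁+t₁≡ = cong₂ _+_ (sym ∑ST₁-degree≡t₁) (trans (sym ∑ST₁-degree≡t₁) (∑-comm (λ x v → ⟦ ST₁ x v ⟧)))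

  degSum*+2[s+t]≤2e+2order* : degSum* + ((s + t) + (s + t)) ≤ (e G SunionT + e G SunionT) + (order* + order*)
  degSum*+2[s+t]≤2e+2order* = begin
    degSum* + ((s + t) + (s + t))                  ≡⟨ cong (λ k → degSum* + (k + k)) order*+t₁≡s+t ⟨
    degSum* + ((order* + t₁) + (order* + t₁))      ≡⟨ regroup degSum* order* t₁ ⟩
    (degSum* + (t₁ + t₁)) + (order* + order*)      ≤⟨ +-monoˡ-≤ (order* + order*) degSum*+2t₁≤2e ⟩
    (e G SunionT + e G SunionT) + (order* + order*) ∎
    where
    open ≤-Reasoning
    open +-*-Solver using (solve; _:=_; _:+_)
    regroup : ∀ d w t → d + ((w + t) + (w + t)) ≡ (d + (t + t)) + (w + w)
    regroup = solve 3 (λ d w t → d :+ ((w :+ t) :+ (w :+ t)) := (d :+ (t :+ t)) :+ (w :+ w)) refl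

  module _ (σ : ℚ) (e≡ : ℕtoℚ (e G SunionT) ≡ (1ℚ +ℚ σ) * ℕtoℚ (s + t)) where

    degSum*-2order*≤2σ[s+t] : ℕtoℚ degSum* - ℕtoℚ 2 * ℕtoℚ order* ≤ℚ ℕtoℚ 2 * σ * ℕtoℚ (s + t)
    degSum*-2order*≤2σ[s+t] = excess-bound degSum* (s + t) (e G SunionT) order* σ degSum*+2[s+t]≤2e+2order* e≡

    excess-of-G* : sumℚ V* (λ v → ℕtoℚ (deg* v) - ℕtoℚ 2) ≤ℚ ℕtoℚ 2 * σ * ℕtoℚ (s + t)
    excess-of-G* = subst (_≤ℚ ℕtoℚ 2 * σ * ℕtoℚ (s + t)) (sym (sumℚ-minus-2 V* deg*)) degSum*-2order*≤2σ[s+t]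

    t₁-lower-bound : ℕtoℚ s - ℕtoℚ 2 * σ * ℕtoℚ (s + t) ≤ℚ ℕtoℚ t₁
    t₁-lower-bound = deficit-bound s order* degSum* t₁ _ s+2order*≤degSum*+t₁ degSum*-2order*≤2σ[s+t]

lemma2p2 : {n : ℕ} (G : SimpleGraph n) → MinDegreeAtLeast G 3 →
    (v₀ : Fin n) (P : List (Fin n)) → IsLongestPathFrom G v₀ P →
    (S : Fin n → Bool) → (∀ v → (S v ≡ true) ⇔ PosaEnd G P v) →
    let open PosaSets G S in
    (∀ v → S₂ v ≡ true →
      ¬ ((∃ λ u → S₂ u ≡ true × adj* v u ≡ true)
         × (∃ λ w → TminusT₁ w ≡ true × adj* v w ≡ true)))
    ×
    (∀ (σ : ℚ) → 0ℚ < σ →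
      ℕtoℚ (e G SunionT) ≡ (1ℚ +ℚ σ) * ℕtoℚ (s + t) →
      (ℕtoℚ s - ℕtoℚ 2 * σ * ℕtoℚ (s + t) ≤ℚ ℕtoℚ t₁)
      × (t₁ ≤ s)
      × (sumℚ V* (λ v → ℕtoℚ (deg* v) - ℕtoℚ 2) ≤ℚ ℕtoℚ 2 * σ * ℕtoℚ (s + t)))
lemma2p2 G min-degree v₀ P P-longest S S⇔PosaEnd =
  (λ v S₂v ((u , S₂u , v*u) , (w , T₂w , v*w)) → S₂-not-between-S₂-and-T₂ S₂v S₂u v*u T₂w v*w) ,
  (λ σ _ e≡ → t₁-lower-bound σ e≡ , t₁≤s , excess-of-G* σ e≡)
  where open PosaPair G min-degree v₀ P P-longest S S⇔PosaEnd
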